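{- Let $\mathbf A$ be a finite integer-valued antipodal metric space of diameter 3, let $M=\{e_1,\dots,e_n\}$ be the set of its pairs at distance 3, and let $\mathbf B$, $p$, $x_i,y_i$, $\psi$ and $\mathbf A'=\psi(\mathbf A)$ be as described in the context. Then $\mathbf B$ is an integer-valued antipodal metric space of diameter 3 which is a coherent EPPA-witness for $\mathbf A'$: there is a map $\varphi\mapsto\theta_\varphi$ from the set of partial automorphisms of $\mathbf A'$ to $\mathrm{Aut}(\mathbf B)$ such that each $\theta_\varphi$ extends $\varphi$ and coherent triples are sent to coherent triples. Moreover, there is a function $\hat p\colon B\to\{0,1\}$ extending $p\circ\psi^{ -1}$ such that whenever a partial automorphism $\varphi$ of $\mathbf A'$ preserves the values of $p\circ\psi^{ -1}$, the automorphism $\theta_\varphi$ preserves the values of $\hat p$.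
   Context: An integer-valued antipodal metric space of diameter 3 is a metric space in which distinct points have distance 1, 2 or 3, with no triangle of distances $2,2,3$, and in which the pairs at distance 3 form a perfect matching. A partial automorphism is an isometry between subspaces whose domain and range are closed under taking antipodal (distance-3) points. A triple $(f,g,h)$ of partial bijections is coherent if $\mathrm{Dom}(f)=\mathrm{Dom}(h)$, $\mathrm{Range}(f)=\mathrm{Dom}(g)$, $\mathrm{Range}(g)=\mathrm{Range}(h)$ and $h=g\circ f$. Construction: for $\chi\colon M\to\{0,1\}$ let $1-\chi$ denote the function $e\mapsto 1-\chi(e)$. The space $\mathbf B$ has as points all pairs $(e,\chi)$ with $e\in M$ and $\chi\colon M\to\{0,1\}$; for distinct points, $d((e,\chi),(e,1-\chi))=3$; otherwise $d((e,\chi),(f,\chi'))=1$ if $\chi(f)=\chi'(e)$ and $d((e,\chi),(f,\chi'))=2$ otherwise. Fix $p\colon A\to\{0,1\}$ with $p(x)=1-p(x')$ whenever $d_{\mathbf A}(x,x')=3$, and for each $i$ let $x_i,y_i$ be the endpoints of $e_i$ with $p(x_i)=0$, $p(y_i)=1$. Define $\chi_i\colon M\to\{0,1\}$ by $\chi_i(e_j)=0$ if $j\ge i$, $\chi_i(e_j)=0$ if $j<i$ and $d_{\mathbf A}(x_i,x_j)=1$, and $\chi_i(e_j)=1$ otherwise. Define $\psi\colon A\to B$ by $\psi(x_i)=(e_i,\chi_i)$, $\psi(y_i)=(e_i,1-\chi_i)$; $\psi$ is an embedding of $\mathbf A$ into $\mathbf B$, and $\mathbf A'=\psi(\mathbf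 A)$. -}

module Defs where

open import Data.Nat using (ℕ; _≤_; _+_; _≟_)
open import Data.Bool using (Bool; true; false; not; if_then_else_; _∧_)
open import Data.Fin using (Fin; toℕ)
import Data.Fin.Properties as FinP
open import Data.Vec using (Vec; tabulate; lookup; map)
import Data.Vec.Properties as VecP
import Data.Bool.Properties as BoolP
open import Data.Maybe using (Maybe; just; nothing; _>>=_)
open import Data.Product using (Σ; ∃; _×_; _,_; proj₁; proj₂)
open import Data.Product.Properties using (≡-dec)
open import Data.Sum using (_⊎_)
open import Relation.Nullary using (¬_; does)
open import Relation.Binary.PropositionalEquality using (_≡_; _≢_; trans; cong)
open import Function using (_⇔_)

record IsAntipodal3 {X : Set} (d : X → X → ℕ) : Set where
  field
    d-refl      : ∀ x → d x x ≡ 0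
    d-distinct  : ∀ x y → x ≢ y → (d x y ≡ 1 ⊎ d x y ≡ 2 ⊎ d x y ≡ 3)
    d-sym       : ∀ x y → d x y ≡ d y x
    d-tri       : ∀ x y z → d x z ≤ d x y + d y z
    no-223      : ∀ x y z → d x y ≡ 2 → d y z ≡ 2 → ¬ (d x z ≡ 3)
    -- the pairs at distance 3 form a perfect matching
    antipode    : ∀ x → ∃ λ y → d x y ≡ 3
    antipode-unique : ∀ x y z → d x y ≡ 3 → d x z ≡ 3 → y ≡ z

-- The space B for M ≅ Fin n (e_i ↦ i); χ : M → {0,1} is a Vec Bool n
-- (false = 0, true = 1), and 1 - χ is map not χ.

PtB : ℕ → Set
PtB n = Fin n × Vec Bool n

_≟B_ : ∀ {n} (u v : PtB n) → _
_≟B_ = ≡-dec FinP._≟_ (VecP.≡-dec BoolP._≟_)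

dB : ∀ {n} → PtB n → PtB n → ℕ
dB {n} (e , χ) (f , χ') =
  if does ((e , χ) ≟B (f , χ')) then 0
  else if (does (e FinP.≟ f) ∧ does (VecP.≡-dec BoolP._≟_ χ' (map not χ))) then 3
  else if does (lookup χ f BoolP.≟ lookup χ' e) then 1
  else 2

-- The embedding ψ : A → B.
-- A has carrier Fin N; M = {e_0,…,e_{n-1}} is enumerated by
-- x : Fin n → Fin N, x i being the endpoint of e_i with p = 0 (false);
-- y i is the antipode of x i.

module Setup {N : ℕ} (dA : Fin N → Fin N → ℕ) (isA : IsAntipodal3 dA)
             (p : Fin N → Bool)
             (p-anti : ∀ a b → dA a b ≡ 3 → p b ≡ not (p a))
             (n : ℕ) (x : Fin n → Fin N)
             (x-p : ∀ i → p (x i) ≡ false)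
             (x-surj : ∀ a → p a ≡ false → Σ (Fin n) λ i → x i ≡ a) where

  open IsAntipodal3 isA

  ant : Fin N → Fin N
  ant a = proj₁ (antipode a)

  y : Fin n → Fin N
  y i = ant (x i)

  χ : Fin n → Vec Bool n
  χ i = tabulate λ j →
    if does (toℕ i Data.Nat.≤? toℕ j) then false
    else if does (dA (x i) (x j) ≟ 1) then false
    else true

  -- index of the matching pair containing a
  idx : Fin N → Fin n
  idx a with p a in eq
  ... | false = proj₁ (x-surj a eq)
  ... | true  = proj₁ (x-surj (ant a)
                  (trans (p-anti a (ant a) (proj₂ (antipode a))) (cong not eq)))

  ψ : Fin N → PtB n
  ψ a = idx a , (if p a then map not (χ (idx a)) else χ (idx a))

PMap : ℕ → Set
PMap n = PtB n → Maybe (PtB n)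

Dom : ∀ {n} → PMap n → PtB n → Set
Dom φ b = ∃ λ c → φ b ≡ just c

Range : ∀ {n} → PMap n → PtB n → Set
Range φ c = ∃ λ b → φ b ≡ just c

Coherent : ∀ {n} → PMap n → PMap n → PMap n → Set
Coherent f g h =
  (∀ b → Dom f b ⇔ Dom h b) ×
  (∀ b → Range f b ⇔ Dom g b) ×
  (∀ b → Range g b ⇔ Range h b) ×
  (∀ b → h b ≡ (f b >>= g))

record IsPartialAut {n} (InS : PtB n → Set) (φ : PMap n) : Set where
  field
    dom-sub   : ∀ b c → φ b ≡ just c → InS b × InS c
    injective : ∀ b b' c → φ b ≡ just c → φ b' ≡ just c → b ≡ b'
    isometry  : ∀ b b' c c' → φ b ≡ just c → φ b' ≡ just c' → dB c c' ≡ dB b b'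
    dom-closed   : ∀ b b' → Dom φ b → dB b b' ≡ 3 → Dom φ b'
    range-closed : ∀ c c' → Range φ c → dB c c' ≡ 3 → Range φ c'

record AutB (n : ℕ) : Set where
  field
    to       : PtB n → PtB n
    from     : PtB n → PtB n
    from-to  : ∀ b → from (to b) ≡ b
    to-from  : ∀ b → to (from b) ≡ b
    isometry : ∀ b b' → dB (to b) (to b') ≡ dB b b'

asPMap : ∀ {n} → AutB n → PMap n
asPMap θ b = just (AutB.to θ b)

module Submission where

-- The proof
-- rests on one family of automorphisms of B, the *switchings*: a permutation
-- σ of M and a symmetric "twist" S : M × M → {0,1} act by
--   (e , c) ↦ (σ e , g ↦ c(σ⁻¹ g) ⊕ S(e , σ⁻¹ g)),
-- and switchings compose as (σ₂ , S₂) ∘ (σ₁ , S₁) = (σ₂σ₁ , S₁ ⊕ S₂ ∘ (σ₁ × σ₁)).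

open import Defs
open import Data.Nat using (ℕ; zero; suc; _+_; _≤_; _<_; z≤n; s≤s; s≤s⁻¹)
import Data.Nat as Nat
import Data.Nat.Properties as NatP
open import Data.Bool using (Bool; true; false; not; _xor_; if_then_else_)
import Data.Bool.Properties as BoolP
open import Data.Fin using (Fin; zero; suc; toℕ)
import Data.Fin.Properties as FinP
open import Data.Fin.Permutation
  using (Permutation′; permutation; _⟨$⟩ʳ_; _⟨$⟩ˡ_; inverseˡ; inverseʳ; flip; _∘ₚ_; _≈_)
import Data.Fin.Permutation as Perm
open import Data.Vec using (Vec; []; _∷_; lookup; map; tabulate)
import Data.Vec.Properties as VecP
open import Data.Maybe using (Maybe; just; nothing; is-just; fromMaybe; _>>=_)
import Data.Maybe as Maybe
open import Data.Product using (Σ; ∃; _×_; _,_; proj₁; proj₂)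
open import Data.Sum using (_⊎_; inj₁; inj₂)
open import Data.Empty using (⊥-elim)
open import Relation.Nullary using (¬_; yes; no; Dec; does; _×-dec_)
open import Relation.Binary.PropositionalEquality
open import Function using (Injective; _⇔_; mk⇔; Equivalence)

lookup-ext : ∀ {A : Set} {n} {u v : Vec A n} → (∀ i → lookup u i ≡ lookup v i) → u ≡ v
lookup-ext {u = u} {v} h =
  trans (sym (VecP.tabulate∘lookup u)) (trans (VecP.tabulate-cong h) (VecP.tabulate∘lookup v))

xor-cancelʳ : ∀ {a b} s → a xor s ≡ b xor s → a ≡ b
xor-cancelʳ {a} {b} s eq = trans (sym (xor-xor a)) (trans (cong (_xor s) eq) (xor-xor b))
  where
  xor-xor : ∀ x → (x xor s) xor s ≡ x
  xor-xor x = trans (BoolP.xor-assoc x s s) (trans (cong (x xor_) (BoolP.xor-same s)) (BoolP.xor-identityʳ x))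

xor-≡ : ∀ {a b c d : Bool} → (a ≡ b ⇔ c ≡ d) → a xor c ≡ b xor d
xor-≡ {true}  {true}  ab⇔cd = cong not (Equivalence.to ab⇔cd refl)
xor-≡ {false} {false} ab⇔cd = Equivalence.to ab⇔cd refl
xor-≡ {true}  {false} {c} {d} ab⇔cd =
  trans (cong not (BoolP.¬-not λ c≡d → BoolP.not-¬ refl (Equivalence.from ab⇔cd c≡d))) (BoolP.not-involutive d)
xor-≡ {false} {true} ab⇔cd = BoolP.¬-not λ c≡d → BoolP.not-¬ refl (Equivalence.from ab⇔cd c≡d)

bool-ext : ∀ {a b : Bool} → (a ≡ true → b ≡ true) → (b ≡ true → a ≡ true) → a ≡ b
bool-ext {true}          a→b _   = sym (a→b refl)
bool-ext {false} {false} _   _   = refl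
bool-ext {false} {true}  _   b→a = b→a refl

just-fromMaybe : ∀ {A : Set} {d : A} m → is-just m ≡ true → m ≡ just (fromMaybe d m)
just-fromMaybe (just _) _ = refl

-- 1. The metric space B.

antipodeB : ∀ {n} → PtB n → PtB n
antipodeB (e , c) = e , map not c

antipodeB-involutive : ∀ {n} (u : PtB n) → antipodeB (antipodeB u) ≡ u
antipodeB-involutive (e , c) =
  cong (e ,_) (trans (sym (VecP.map-∘ not not c)) (trans (VecP.map-cong BoolP.not-involutive c) (VecP.map-id c)))

antipodeB-swap : ∀ {n} {u v : PtB n} → v ≡ antipodeB u → u ≡ antipodeB v
antipodeB-swap {u = u} refl = sym (antipodeB-involutive u)

-- Two points (e , c), (f , c') "agree" when c(f) = c'(e); off the diagonal
-- and the antipodal pairs this is exactly distance 1.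
Agree : ∀ {n} → PtB n → PtB n → Set
Agree (e , c) (f , c') = lookup c f ≡ lookup c' e

data DistanceView {n} (u v : PtB n) : ℕ → Set where
  dist0 : u ≡ v → DistanceView u v 0
  dist3 : u ≢ v → v ≡ antipodeB u → DistanceView u v 3
  dist1 : u ≢ v → v ≢ antipodeB u → Agree u v → DistanceView u v 1
  dist2 : u ≢ v → v ≢ antipodeB u → ¬ Agree u v → DistanceView u v 2

agree? : ∀ {n} (u v : PtB n) → Dec (Agree u v)
agree? (e , c) (f , c') = lookup c f BoolP.≟ lookup c' e

agreementView : ∀ {n} {u v : PtB n} → u ≢ v → v ≢ antipodeB u →
                DistanceView u v (if does (agree? u v) then 1 else 2)
agreementView {u = u} {v} u≢v v≢ with agree? u v
... | yes a = dist1 u≢v v≢ a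
... | no ¬a = dist2 u≢v v≢ ¬a

distanceView : ∀ {n} (u v : PtB n) → DistanceView u v (dB u v)
distanceView (e , c) (f , c') with (e , c) ≟B (f , c')
... | yes u≡v = dist0 u≡v
... | no u≢v with e FinP.≟ f | VecP.≡-dec BoolP._≟_ c' (map not c)
...   | yes refl | yes refl = dist3 u≢v refl
...   | yes refl | no c'≢ = agreementView u≢v (λ eq → c'≢ (cong proj₂ eq))
...   | no e≢f   | _      = agreementView u≢v (λ eq → e≢f (sym (cong proj₁ eq)))

dB-antipode : ∀ {n} (u : PtB n) → dB u (antipodeB u) ≡ 3
dB-antipode u with dB u (antipodeB u) | distanceView u (antipodeB u)
... | _ | dist0 u≡ū     = ⊥-elim (c≢notc (cong proj₂ u≡ū))
  where
  c≢notc : proj₂ u ≢ map not (proj₂ u)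
  c≢notc eq = BoolP.not-¬ refl
    (trans (cong (λ c → lookup c (proj₁ u)) eq) (VecP.lookup-map (proj₁ u) not (proj₂ u)))
... | _ | dist3 _ _     = refl
... | _ | dist1 _ ū≢ _  = ⊥-elim (ū≢ refl)
... | _ | dist2 _ ū≢ _  = ⊥-elim (ū≢ refl)

dB≡0⇒≡ : ∀ {n} (u v : PtB n) → dB u v ≡ 0 → u ≡ v
dB≡0⇒≡ u v h with dB u v | distanceView u v
dB≡0⇒≡ _ _ refl | _ | dist0 u≡v = u≡v

dB≡3⇒antipode : ∀ {n} (u v : PtB n) → dB u v ≡ 3 → v ≡ antipodeB u
dB≡3⇒antipode u v h with dB u v | distanceView u v
dB≡3⇒antipode _ _ refl | _ | dist3 _ v≡ū = v≡ū

dB≡1⇒agree : ∀ {n} (u v : PtB n) → dB u v ≡ 1 → Agree u v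
dB≡1⇒agree u v h with dB u v | distanceView u v
dB≡1⇒agree _ _ refl | _ | dist1 _ _ a = a

dB≡2⇒disagree : ∀ {n} (u v : PtB n) → dB u v ≡ 2 → ¬ Agree u v
dB≡2⇒disagree u v h with dB u v | distanceView u v
dB≡2⇒disagree _ _ refl | _ | dist2 _ _ ¬a = ¬a

-- dB u v depends only on whether u = v, whether v is the antipode of u, and
-- whether u and v agree; so any map preserving these three relations is an
-- isometry of B.
dB-determined : ∀ {n} (u v u' v' : PtB n) →
  (u ≡ v ⇔ u' ≡ v') → (v ≡ antipodeB u ⇔ v' ≡ antipodeB u') → (Agree u v ⇔ Agree u' v') →
  dB u v ≡ dB u' v'
dB-determined u v u' v' same anti agree = compare (distanceView u v) (distanceView u' v')
  where
  open Equivalence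
  compare : ∀ {m m'} → DistanceView u v m → DistanceView u' v' m' → m ≡ m'
  compare (dist0 _)     (dist0 _)     = refl
  compare (dist0 u≡v)   (dist3 ≢ _)   = ⊥-elim (≢ (to same u≡v))
  compare (dist0 u≡v)   (dist1 ≢ _ _) = ⊥-elim (≢ (to same u≡v))
  compare (dist0 u≡v)   (dist2 ≢ _ _) = ⊥-elim (≢ (to same u≡v))
  compare (dist3 ≢ _)   (dist0 e)     = ⊥-elim (≢ (from same e))
  compare (dist1 ≢ _ _) (dist0 e)     = ⊥-elim (≢ (from same e))
  compare (dist2 ≢ _ _) (dist0 e)     = ⊥-elim (≢ (from same e))
  compare (dist3 _ _)   (dist3 _ _)   = refl
  compare (dist3 _ a)   (dist1 _ ≢ _) = ⊥-elim (≢ (to anti a))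
  compare (dist3 _ a)   (dist2 _ ≢ _) = ⊥-elim (≢ (to anti a))
  compare (dist1 _ ≢ _) (dist3 _ a)   = ⊥-elim (≢ (from anti a))
  compare (dist2 _ ≢ _) (dist3 _ a)   = ⊥-elim (≢ (from anti a))
  compare (dist1 _ _ _) (dist1 _ _ _) = refl
  compare (dist2 _ _ _) (dist2 _ _ _) = refl
  compare (dist1 _ _ a) (dist2 _ _ ¬a) = ⊥-elim (¬a (to agree a))
  compare (dist2 _ _ ¬a) (dist1 _ _ a) = ⊥-elim (¬a (from agree a))

dB-sym : ∀ {n} (u v : PtB n) → dB u v ≡ dB v u
dB-sym u v = dB-determined u v v u (mk⇔ sym sym) (mk⇔ antipodeB-swap antipodeB-swap) (mk⇔ sym sym)

dB-self : ∀ {n} (u : PtB n) → dB u u ≡ 0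
dB-self u with dB u u | distanceView u u
... | _ | dist0 _       = refl
... | _ | dist3 ≢ _     = ⊥-elim (≢ refl)
... | _ | dist1 ≢ _ _   = ⊥-elim (≢ refl)
... | _ | dist2 ≢ _ _   = ⊥-elim (≢ refl)

dB-distinct : ∀ {n} (u v : PtB n) → u ≢ v → dB u v ≡ 1 ⊎ dB u v ≡ 2 ⊎ dB u v ≡ 3
dB-distinct u v u≢v with dB u v | distanceView u v
... | _ | dist0 u≡v   = ⊥-elim (u≢v u≡v)
... | _ | dist1 _ _ _ = inj₁ refl
... | _ | dist2 _ _ _ = inj₂ (inj₁ refl)
... | _ | dist3 _ _   = inj₂ (inj₂ refl)

dB≤3 : ∀ {n} (u v : PtB n) → dB u v ≤ 3
dB≤3 u v with dB u v | distanceView u v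
... | _ | dist0 _     = z≤n
... | _ | dist1 _ _ _ = s≤s z≤n
... | _ | dist2 _ _ _ = s≤s (s≤s z≤n)
... | _ | dist3 _ _   = NatP.≤-refl

-- Both forbidden triangles (1,1,3) and (2,2,3) reduce to c(f) = not c(f):
-- agreement with u and with its antipode ū are complementary conditions.
no-113 : ∀ {n} (u v w : PtB n) → dB u v ≡ 1 → dB v w ≡ 1 → dB u w ≢ 3
no-113 u v w uv vw uw with dB≡3⇒antipode u w uw
no-113 (e , c) (f , c') _ uv vw uw | refl =
  BoolP.not-¬ refl (trans (dB≡1⇒agree (e , c) (f , c') uv)
    (trans (dB≡1⇒agree (f , c') (e , map not c) vw) (VecP.lookup-map f not c)))

no-223 : ∀ {n} (u v w : PtB n) → dB u v ≡ 2 → dB v w ≡ 2 → dB u w ≢ 3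
no-223 u v w uv vw uw with dB≡3⇒antipode u w uw
no-223 (e , c) (f , c') _ uv vw uw | refl =
  dB≡2⇒disagree (e , c) (f , c') uv (sym (trans (BoolP.¬-not (dB≡2⇒disagree (f , c') (e , map not c) vw))
    (trans (cong not (VecP.lookup-map f not c)) (BoolP.not-involutive (lookup c f)))))

triangle-from-cases : ∀ a b c → c ≤ 3 → (a ≡ 0 → c ≡ b) → (b ≡ 0 → c ≡ a) →
                      (a ≡ 1 → b ≡ 1 → c ≢ 3) → c ≤ a + b
triangle-from-cases zero b c _ a0 _ _ = NatP.≤-reflexive (a0 refl)
triangle-from-cases (suc a) zero c _ _ b0 _ = NatP.≤-reflexive (trans (b0 refl) (sym (NatP.+-identityʳ (suc a))))
triangle-from-cases 1 1 c c≤3 _ _ no113 = s≤s⁻¹ (NatP.≤∧≢⇒< c≤3 (no113 refl refl))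
triangle-from-cases 1 (suc (suc b)) c c≤3 _ _ _ = NatP.≤-trans c≤3 (s≤s (s≤s (s≤s z≤n)))
triangle-from-cases (suc (suc a)) (suc b) c c≤3 _ _ _ =
  NatP.≤-trans c≤3 (s≤s (s≤s (NatP.≤-trans (s≤s z≤n) (NatP.m≤n+m (suc b) a))))

dB-tri : ∀ {n} (u v w : PtB n) → dB u w ≤ dB u v + dB v w
dB-tri u v w = triangle-from-cases (dB u v) (dB v w) (dB u w) (dB≤3 u w)
  (λ uv → cong (λ z → dB z w) (dB≡0⇒≡ u v uv))
  (λ vw → cong (dB u) (sym (dB≡0⇒≡ v w vw)))
  (no-113 u v w)

B-isAntipodal3 : ∀ {n} → IsAntipodal3 (dB {n})
B-isAntipodal3 = record
  { d-refl          = dB-self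
  ; d-distinct      = dB-distinct
  ; d-sym           = dB-sym
  ; d-tri           = dB-tri
  ; no-223          = no-223
  ; antipode        = λ u → antipodeB u , dB-antipode u
  ; antipode-unique = λ u v w uv uw → trans (dB≡3⇒antipode u v uv) (sym (dB≡3⇒antipode u w uw))
  }

dB≡1⇔agree : ∀ {n} (u v : PtB n) → proj₁ u ≢ proj₁ v → dB u v ≡ 1 ⇔ Agree u v
dB≡1⇔agree u v e≢f with dB u v | distanceView u v
... | _ | dist0 u≡v   = ⊥-elim (e≢f (cong proj₁ u≡v))
... | _ | dist3 _ v≡ū = ⊥-elim (e≢f (sym (cong proj₁ v≡ū)))
... | _ | dist1 _ _ a  = mk⇔ (λ _ → a) (λ _ → refl)
... | _ | dist2 _ _ ¬a = mk⇔ (λ ()) (λ a → ⊥-elim (¬a a))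

isometry-agree : ∀ {n} (u v u' v' : PtB n) → dB u' v' ≡ dB u v →
  proj₁ u ≢ proj₁ v → proj₁ u' ≢ proj₁ v' → Agree u v ⇔ Agree u' v'
isometry-agree u v u' v' same e≢f e'≢f' = mk⇔
  (λ a → Equivalence.to (dB≡1⇔agree u' v' e'≢f') (trans same (Equivalence.from (dB≡1⇔agree u v e≢f) a)))
  (λ a → Equivalence.to (dB≡1⇔agree u v e≢f) (trans (sym same) (Equivalence.from (dB≡1⇔agree u' v' e'≢f') a)))

lookup-ext-along : ∀ {A : Set} {n} (π : Permutation′ n) {u v : Vec A n} →
  (∀ j → lookup u (π ⟨$⟩ʳ j) ≡ lookup v (π ⟨$⟩ʳ j)) → u ≡ v
lookup-ext-along π {u} {v} h = lookup-ext λ g →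
  subst (λ i → lookup u i ≡ lookup v i) (inverseʳ π) (h (π ⟨$⟩ˡ g))

-- 2. Switchings.

switch : ∀ {n} (σ σ⁻¹ : Fin n → Fin n) (S : Fin n → Fin n → Bool) → PtB n → PtB n
switch σ σ⁻¹ S (e , c) = σ e , tabulate λ g → lookup c (σ⁻¹ g) xor S e (σ⁻¹ g)

switchBy : ∀ {n} → Permutation′ n → (Fin n → Fin n → Bool) → PtB n → PtB n
switchBy π S = switch (π ⟨$⟩ʳ_) (π ⟨$⟩ˡ_) S

-- Switchings are isometries exactly when the twist is symmetric.
Symmetric : ∀ {n} → (Fin n → Fin n → Bool) → Set
Symmetric S = ∀ e f → S e f ≡ S f e

lookup-switch : ∀ {n} (π : Permutation′ n) S e (c : Vec Bool n) f →
  lookup (proj₂ (switchBy π S (e , c))) (π ⟨$⟩ʳ f) ≡ lookup c f xor S e f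
lookup-switch π S e c f =
  trans (VecP.lookup∘tabulate _ (π ⟨$⟩ʳ f)) (cong (λ i → lookup c i xor S e i) (inverseˡ π))

switch-∘ : ∀ {n} (π₁ π₂ π₃ : Permutation′ n) (S₁ S₂ S₃ : Fin n → Fin n → Bool) →
  π₃ ≈ π₁ ∘ₚ π₂ → (∀ e j → S₃ e j ≡ S₁ e j xor S₂ (π₁ ⟨$⟩ʳ e) (π₁ ⟨$⟩ʳ j)) →
  ∀ b → switchBy π₃ S₃ b ≡ switchBy π₂ S₂ (switchBy π₁ S₁ b)
switch-∘ π₁ π₂ π₃ S₁ S₂ S₃ π₃≈ S₃≡ (e , c) = cong₂ _,_ (π₃≈ e) (lookup-ext-along π₃ λ j →
  begin
    lookup (proj₂ (switchBy π₃ S₃ (e , c))) (π₃ ⟨$⟩ʳ j)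
  ≡⟨ lookup-switch π₃ S₃ e c j ⟩
    lookup c j xor S₃ e j
  ≡⟨ cong (lookup c j xor_) (S₃≡ e j) ⟩
    lookup c j xor (S₁ e j xor S₂ (π₁ ⟨$⟩ʳ e) (π₁ ⟨$⟩ʳ j))
  ≡⟨ sym (BoolP.xor-assoc (lookup c j) _ _) ⟩
    (lookup c j xor S₁ e j) xor S₂ (π₁ ⟨$⟩ʳ e) (π₁ ⟨$⟩ʳ j)
  ≡⟨ cong (_xor S₂ (π₁ ⟨$⟩ʳ e) (π₁ ⟨$⟩ʳ j)) (sym (lookup-switch π₁ S₁ e c j)) ⟩
    lookup c₁ (π₁ ⟨$⟩ʳ j) xor S₂ (π₁ ⟨$⟩ʳ e) (π₁ ⟨$⟩ʳ j)
  ≡⟨ sym (lookup-switch π₂ S₂ (π₁ ⟨$⟩ʳ e) c₁ (π₁ ⟨$⟩ʳ j)) ⟩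
    lookup (proj₂ (switchBy π₂ S₂ (switchBy π₁ S₁ (e , c)))) (π₂ ⟨$⟩ʳ (π₁ ⟨$⟩ʳ j))
  ≡⟨ cong (lookup (proj₂ (switchBy π₂ S₂ (switchBy π₁ S₁ (e , c))))) (sym (π₃≈ j)) ⟩
    lookup (proj₂ (switchBy π₂ S₂ (switchBy π₁ S₁ (e , c)))) (π₃ ⟨$⟩ʳ j)
  ∎)
  where
  open ≡-Reasoning
  c₁ = proj₂ (switchBy π₁ S₁ (e , c))

switch-id : ∀ {n} (b : PtB n) → switchBy Perm.id (λ _ _ → false) b ≡ b
switch-id (e , c) = cong (e ,_) (lookup-ext λ g →
  trans (VecP.lookup∘tabulate _ g) (BoolP.xor-identityʳ (lookup c g)))

switchInverse : ∀ {n} → Permutation′ n → (Fin n → Fin n → Bool) → PtB n → PtB n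
switchInverse π S = switchBy (flip π) (λ a b → S (π ⟨$⟩ˡ a) (π ⟨$⟩ˡ b))

switchInverse-switch : ∀ {n} (π : Permutation′ n) S (b : PtB n) → switchInverse π S (switchBy π S b) ≡ b
switchInverse-switch π S b = trans (sym (switch-∘ π (flip π) Perm.id S S⁻¹ (λ _ _ → false)
  (λ i → sym (inverseˡ π)) cancel b)) (switch-id b)
  where
  S⁻¹ = λ a b → S (π ⟨$⟩ˡ a) (π ⟨$⟩ˡ b)
  cancel : ∀ e j → false ≡ S e j xor S (π ⟨$⟩ˡ (π ⟨$⟩ʳ e)) (π ⟨$⟩ˡ (π ⟨$⟩ʳ j))
  cancel e j rewrite inverseˡ π {e} | inverseˡ π {j} = sym (BoolP.xor-same (S e j))

switch-switchInverse : ∀ {n} (π : Permutation′ n) S (b : PtB n) → switchBy π S (switchInverse π S b) ≡ b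
switch-switchInverse π S b = trans (sym (switch-∘ (flip π) π Perm.id S⁻¹ S (λ _ _ → false)
  (λ i → sym (inverseʳ π)) (λ e j → sym (BoolP.xor-same (S (π ⟨$⟩ˡ e) (π ⟨$⟩ˡ j)))) b)) (switch-id b)
  where
  S⁻¹ = λ a b → S (π ⟨$⟩ˡ a) (π ⟨$⟩ˡ b)

switch-injective : ∀ {n} (π : Permutation′ n) S {b b' : PtB n} → switchBy π S b ≡ switchBy π S b' → b ≡ b'
switch-injective π S {b} {b'} eq =
  trans (sym (switchInverse-switch π S b)) (trans (cong (switchInverse π S) eq) (switchInverse-switch π S b'))

-- Switching commutes with taking antipodes, since 1 - (c ⊕ s) = (1 - c) ⊕ s.
switch-antipode : ∀ {n} (π : Permutation′ n) S (u : PtB n) →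
  switchBy π S (antipodeB u) ≡ antipodeB (switchBy π S u)
switch-antipode π S (e , c) = cong (π ⟨$⟩ʳ e ,_) (lookup-ext-along π λ j →
  begin
    lookup (proj₂ (switchBy π S (e , map not c))) (π ⟨$⟩ʳ j)
  ≡⟨ lookup-switch π S e (map not c) j ⟩
    lookup (map not c) j xor S e j
  ≡⟨ cong (_xor S e j) (VecP.lookup-map j not c) ⟩
    not (lookup c j) xor S e j
  ≡⟨ sym (BoolP.not-distribˡ-xor (lookup c j) (S e j)) ⟩
    not (lookup c j xor S e j)
  ≡⟨ cong not (sym (lookup-switch π S e c j)) ⟩
    not (lookup c' (π ⟨$⟩ʳ j))
  ≡⟨ sym (VecP.lookup-map (π ⟨$⟩ʳ j) not c') ⟩
    lookup (map not c') (π ⟨$⟩ʳ j)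
  ∎)
  where
  open ≡-Reasoning
  c' = proj₂ (switchBy π S (e , c))

-- For a symmetric twist, switching preserves agreement: both sides of
-- c(f) = c'(e) get the same summand S(e , f) = S(f , e).
switch-agree : ∀ {n} (π : Permutation′ n) S → Symmetric S → ∀ (u v : PtB n) →
  Agree u v ⇔ Agree (switchBy π S u) (switchBy π S v)
switch-agree π S S-sym (e , c) (f , c') = mk⇔
  (λ a → trans (lookup-switch π S e c f)
           (trans (cong₂ _xor_ a (S-sym e f)) (sym (lookup-switch π S f c' e))))
  (λ a → xor-cancelʳ (S e f)
           (trans (sym (lookup-switch π S e c f))
           (trans a (trans (lookup-switch π S f c' e) (cong (lookup c' e xor_) (S-sym f e))))))

switch-isometry : ∀ {n} (π : Permutation′ n) S → Symmetric S → ∀ (u v : PtB n) →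
  dB (switchBy π S u) (switchBy π S v) ≡ dB u v
switch-isometry π S S-sym u v = sym (dB-determined u v (switchBy π S u) (switchBy π S v)
  (mk⇔ (cong (switchBy π S)) (switch-injective π S))
  (mk⇔ (λ v≡ū → trans (cong (switchBy π S) v≡ū) (switch-antipode π S u))
       (λ eq → switch-injective π S (trans eq (sym (switch-antipode π S u)))))
  (switch-agree π S S-sym u v))

switchAut : ∀ {n} (π : Permutation′ n) S → Symmetric S → AutB n
switchAut π S S-sym = record
  { to       = switchBy π S
  ; from     = switchInverse π S
  ; from-to  = switchInverse-switch π S
  ; to-from  = switch-switchInverse π S
  ; isometry = switch-isometry π S S-sym
  }

-- Automorphisms are total, so a triple of them is coherent as soon as the
-- third is the composite of the first two.
aut-coherent : ∀ {n} (θf θg θh : AutB n) → (∀ b → AutB.to θh b ≡ AutB.to θg (AutB.to θf b)) →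
  Coherent (asPMap θf) (asPMap θg) (asPMap θh)
aut-coherent θf θg θh h≡g∘f =
  (λ b → mk⇔ (λ _ → _ , refl) (λ _ → _ , refl)) ,
  (λ b → mk⇔ (λ _ → _ , refl) (λ _ → AutB.from θf b , cong just (AutB.to-from θf b))) ,
  (λ b → mk⇔ (λ _ → AutB.from θh b , cong just (AutB.to-from θh b))
             (λ _ → AutB.from θg b , cong just (AutB.to-from θg b))) ,
  (λ b → cong just (h≡g∘f b))

diagonal : ∀ {n} → PtB n → Bool
diagonal (e , c) = lookup c e

switch-diagonal : ∀ {n} (π : Permutation′ n) S → (∀ e → S e e ≡ false) →
  ∀ b → diagonal (switchBy π S b) ≡ diagonal b
switch-diagonal π S S-diag (e , c) =
  trans (lookup-switch π S e c e) (trans (cong (lookup c e xor_) (S-diag e)) (BoolP.xor-identityʳ (lookup c e)))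

-- 3. Extending partial injections of M to permutations, coherently.

-- A subset of Fin n is a Vec Bool n; its gaps are the positions marked false.
gapCount : ∀ {n} → Vec Bool n → ℕ
gapCount []          = 0
gapCount (true ∷ D)  = gapCount D
gapCount (false ∷ D) = suc (gapCount D)

memberCount : ∀ {n} → Vec Bool n → ℕ
memberCount []          = 0
memberCount (true ∷ D)  = suc (memberCount D)
memberCount (false ∷ D) = memberCount D

gapRank : ∀ {n} → Vec Bool n → Fin n → ℕ
gapRank (_ ∷ D)     zero    = 0
gapRank (true ∷ D)  (suc i) = gapRank D i
gapRank (false ∷ D) (suc i) = suc (gapRank D i)

nthGap : ∀ {n} → Vec Bool n → ℕ → Maybe (Fin n)
nthGap []          _       = nothing
nthGap (true ∷ D)  k       = Maybe.map suc (nthGap D k)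
nthGap (false ∷ D) zero    = just zero
nthGap (false ∷ D) (suc k) = Maybe.map suc (nthGap D k)

gapRank<gapCount : ∀ {n} (D : Vec Bool n) i → lookup D i ≡ false → gapRank D i < gapCount D
gapRank<gapCount (false ∷ D) zero    _   = s≤s z≤n
gapRank<gapCount (true ∷ D)  (suc i) Di = gapRank<gapCount D i Di
gapRank<gapCount (false ∷ D) (suc i) Di = s≤s (gapRank<gapCount D i Di)

nthGap-exists : ∀ {n} (D : Vec Bool n) k → k < gapCount D →
  ∃ λ j → nthGap D k ≡ just j × lookup D j ≡ false × gapRank D j ≡ k
nthGap-exists (true ∷ D) k lt with nthGap-exists D k lt
... | j , nth , Dj , rank = suc j , cong (Maybe.map suc) nth , Dj , rank
nthGap-exists (false ∷ D) zero    _          = zero , refl , refl , refl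
nthGap-exists (false ∷ D) (suc k) (s≤s lt) with nthGap-exists D k lt
... | j , nth , Dj , rank = suc j , cong (Maybe.map suc) nth , Dj , cong suc rank

nthGap-gapRank : ∀ {n} (D : Vec Bool n) j → lookup D j ≡ false → nthGap D (gapRank D j) ≡ just j
nthGap-gapRank (false ∷ D) zero    _  = refl
nthGap-gapRank (true ∷ D)  (suc j) Dj = cong (Maybe.map suc) (nthGap-gapRank D j Dj)
nthGap-gapRank (false ∷ D) (suc j) Dj = cong (Maybe.map suc) (nthGap-gapRank D j Dj)

matchGaps : ∀ {n} → Vec Bool n → Vec Bool n → Fin n → Fin n
matchGaps D R i = fromMaybe i (nthGap R (gapRank D i))

matchGaps-spec : ∀ {n} (D R : Vec Bool n) → gapCount D ≡ gapCount R → ∀ i → lookup D i ≡ false →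
  nthGap R (gapRank D i) ≡ just (matchGaps D R i) ×
  lookup R (matchGaps D R i) ≡ false × gapRank R (matchGaps D R i) ≡ gapRank D i
matchGaps-spec D R same i Di
  with nthGap R (gapRank D i)
     | nthGap-exists R (gapRank D i) (subst (gapRank D i <_) same (gapRank<gapCount D i Di))
... | .(just j) | j , refl , Rj , rank = refl , Rj , rank

matchGaps-∘ : ∀ {n} (D R R' : Vec Bool n) → gapCount D ≡ gapCount R → gapCount D ≡ gapCount R' →
  ∀ i → lookup D i ≡ false → matchGaps R R' (matchGaps D R i) ≡ matchGaps D R' i
matchGaps-∘ D R R' DR DR' i Di =
  begin
    fromMaybe (matchGaps D R i) (nthGap R' (gapRank R (matchGaps D R i)))
  ≡⟨ cong (λ k → fromMaybe (matchGaps D R i) (nthGap R' k)) (proj₂ (proj₂ (matchGaps-spec D R DR i Di))) ⟩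
    fromMaybe (matchGaps D R i) (nthGap R' (gapRank D i))
  ≡⟨ cong (fromMaybe (matchGaps D R i)) (proj₁ (matchGaps-spec D R' DR' i Di)) ⟩
    matchGaps D R' i
  ∎
  where open ≡-Reasoning

matchGaps-inverse : ∀ {n} (D R : Vec Bool n) → gapCount D ≡ gapCount R →
  ∀ i → lookup D i ≡ false → matchGaps R D (matchGaps D R i) ≡ i
matchGaps-inverse D R DR i Di =
  cong (fromMaybe (matchGaps D R i))
    (trans (cong (nthGap D) (proj₂ (proj₂ (matchGaps-spec D R DR i Di)))) (nthGap-gapRank D i Di))

InjectiveOn : ∀ {n m} → Vec Bool n → (Fin n → Fin m) → Set
InjectiveOn D f = ∀ i i' → lookup D i ≡ true → lookup D i' ≡ true → f i ≡ f i' → i ≡ i'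

remove : ∀ {m} → Vec Bool m → Fin m → Vec Bool m
remove (_ ∷ R) zero    = false ∷ R
remove (b ∷ R) (suc j) = b ∷ remove R j

memberCount-remove : ∀ {m} (R : Vec Bool m) j → lookup R j ≡ true → memberCount R ≡ suc (memberCount (remove R j))
memberCount-remove (true ∷ R)  zero    _  = refl
memberCount-remove (true ∷ R)  (suc j) Rj = cong suc (memberCount-remove R j Rj)
memberCount-remove (false ∷ R) (suc j) Rj = memberCount-remove R j Rj

lookup-remove : ∀ {m} (R : Vec Bool m) j k → k ≢ j → lookup (remove R j) k ≡ lookup R k
lookup-remove (_ ∷ R) zero    zero    k≢j = ⊥-elim (k≢j refl)
lookup-remove (_ ∷ R) zero    (suc k) _   = refl
lookup-remove (_ ∷ R) (suc j) zero    _   = refl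
lookup-remove (_ ∷ R) (suc j) (suc k) k≢j = lookup-remove R j k (λ k≡j → k≢j (cong suc k≡j))

memberCount-≤ : ∀ {n m} (D : Vec Bool n) (R : Vec Bool m) (f : Fin n → Fin m) →
  (∀ i → lookup D i ≡ true → lookup R (f i) ≡ true) → InjectiveOn D f →
  memberCount D ≤ memberCount R
memberCount-≤ []          R f _    _   = z≤n
memberCount-≤ (false ∷ D) R f into inj =
  memberCount-≤ D R (λ i → f (suc i)) (λ i → into (suc i))
    (λ i i' Di Di' eq → FinP.suc-injective (inj _ _ Di Di' eq))
memberCount-≤ (true ∷ D) R f into inj =
  subst (suc (memberCount D) ≤_) (sym (memberCount-remove R (f zero) (into zero refl)))
    (s≤s (memberCount-≤ D (remove R (f zero)) (λ i → f (suc i)) into′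
      (λ i i' Di Di' eq → FinP.suc-injective (inj _ _ Di Di' eq))))
  where
  into′ : ∀ i → lookup D i ≡ true → lookup (remove R (f zero)) (f (suc i)) ≡ true
  into′ i Di = trans (lookup-remove R (f zero) (f (suc i)) (λ eq → zero≢suc (inj _ _ refl Di (sym eq))))
                     (into (suc i) Di)
    where
    zero≢suc : ∀ {k} {i : Fin k} → zero ≢ suc i
    zero≢suc ()

gapCount+memberCount : ∀ {n} (D : Vec Bool n) → gapCount D + memberCount D ≡ n
gapCount+memberCount []          = refl
gapCount+memberCount (true ∷ D)  = trans (NatP.+-suc (gapCount D) (memberCount D)) (cong suc (gapCount+memberCount D))
gapCount+memberCount (false ∷ D) = cong suc (gapCount+memberCount D)

gapCount-≡ : ∀ {n} (D R : Vec Bool n) → memberCount D ≡ memberCount R → gapCount D ≡ gapCount R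
gapCount-≡ D R same = NatP.+-cancelʳ-≡ (memberCount R) (gapCount D) (gapCount R)
  (trans (cong (gapCount D +_) (sym same)) (trans (gapCount+memberCount D) (sym (gapCount+memberCount R))))

-- Extending a partial injection s of Fin n with domain D to a permutation:
-- on D use s, and match the gaps of D with the gaps of the image in order.
module Extension {n} (D : Vec Bool n) (s : Fin n → Fin n) where

  preimage? : ∀ j → Dec (∃ λ i → lookup D i ≡ true × s i ≡ j)
  preimage? j = FinP.any? λ i → (lookup D i BoolP.≟ true) ×-dec (s i FinP.≟ j)

  image : Vec Bool n
  image = tabulate λ j → does (preimage? j)

  preimage : Fin n → Fin n
  preimage j with preimage? j
  ... | yes (i , _) = i
  ... | no _        = j

  extend : Fin n → Fin n
  extend i = if lookup D i then s i else matchGaps D image i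

  extend⁻¹ : Fin n → Fin n
  extend⁻¹ j = if lookup image j then preimage j else matchGaps image D j

  image-s : ∀ i → lookup D i ≡ true → lookup image (s i) ≡ true
  image-s i Di rewrite VecP.lookup∘tabulate (λ j → does (preimage? j)) (s i) with preimage? (s i)
  ... | yes _ = refl
  ... | no ∄  = ⊥-elim (∄ (i , Di , refl))

  preimage-spec : ∀ j → lookup image j ≡ true → lookup D (preimage j) ≡ true × s (preimage j) ≡ j
  preimage-spec j Rj rewrite VecP.lookup∘tabulate (λ j → does (preimage? j)) j with preimage? j | Rj
  ... | yes (_ , Di , si≡j) | _ = Di , si≡j

  extend-in : ∀ i → lookup D i ≡ true → extend i ≡ s i
  extend-in i Di rewrite Di = refl

  module _ (inj : InjectiveOn D s) where

    preimage-s : ∀ i → lookup D i ≡ true → preimage (s i) ≡ i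
    preimage-s i Di = let (Dp , sp) = preimage-spec (s i) (image-s i Di) in inj _ _ Dp Di sp

    -- s restricted to D is a bijection onto image, so the complements are
    -- equinumerous as well.
    gapCount-image : gapCount D ≡ gapCount image
    gapCount-image = gapCount-≡ D image (NatP.≤-antisym
      (memberCount-≤ D image s image-s inj)
      (memberCount-≤ image D preimage (λ j Rj → proj₁ (preimage-spec j Rj))
        (λ j j' Rj Rj' eq → trans (sym (proj₂ (preimage-spec j Rj)))
                              (trans (cong s eq) (proj₂ (preimage-spec j' Rj'))))))

    matchGaps-gap : ∀ i → lookup D i ≡ false → lookup image (matchGaps D image i) ≡ false
    matchGaps-gap i Di = proj₁ (proj₂ (matchGaps-spec D image gapCount-image i Di))

    extend-gap : ∀ i → lookup D i ≡ false → lookup image (extend i) ≡ false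
    extend-gap i Di rewrite Di = matchGaps-gap i Di

    extend⁻¹-extend : ∀ i → extend⁻¹ (extend i) ≡ i
    extend⁻¹-extend i with lookup D i in Di
    ... | true  rewrite image-s i Di = preimage-s i Di
    ... | false rewrite matchGaps-gap i Di =
      matchGaps-inverse D image gapCount-image i Di

    extend-extend⁻¹ : ∀ j → extend (extend⁻¹ j) ≡ j
    extend-extend⁻¹ j with lookup image j in Rj
    ... | true  rewrite proj₁ (preimage-spec j Rj) = proj₂ (preimage-spec j Rj)
    ... | false rewrite proj₁ (proj₂ (matchGaps-spec image D (sym gapCount-image) j Rj)) =
      matchGaps-inverse image D (sym gapCount-image) j Rj

    extension : Permutation′ n
    extension = permutation extend extend⁻¹ extend-extend⁻¹ extend⁻¹-extend

extend-∘ : ∀ {n} (D₁ D₂ D₃ : Vec Bool n) (s₁ s₂ s₃ : Fin n → Fin n) →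
  InjectiveOn D₁ s₁ → InjectiveOn D₂ s₂ →
  D₃ ≡ D₁ → Extension.image D₁ s₁ ≡ D₂ → Extension.image D₃ s₃ ≡ Extension.image D₂ s₂ →
  (∀ i → lookup D₁ i ≡ true → s₃ i ≡ s₂ (s₁ i)) →
  ∀ i → Extension.extend D₃ s₃ i ≡ Extension.extend D₂ s₂ (Extension.extend D₁ s₁ i)
extend-∘ D₁ D₂ D₃ s₁ s₂ s₃ s₁-inj s₂-inj refl refl R₃≡R₂ s₃≡ i with lookup D₁ i in Di
... | true  rewrite Extension.image-s D₁ s₁ i Di = s₃≡ i Di
... | false rewrite R₃≡R₂ | Extension.matchGaps-gap D₁ s₁ s₁-inj i Di =
  sym (matchGaps-∘ D₁ (Extension.image D₁ s₁) (Extension.image D₂ s₂) c₁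
                   (trans c₁ (Extension.gapCount-image D₂ s₂ s₂-inj)) i Di)
  where
  c₁ = Extension.gapCount-image D₁ s₁ s₁-inj

-- 4. Switchings induced by partial automorphisms of A'.

partialAut-antipode : ∀ {n} {InS : PtB n → Set} {φ : PMap n} → IsPartialAut InS φ →
  ∀ u c → φ u ≡ just c → φ (antipodeB u) ≡ just (antipodeB c)
partialAut-antipode pa u c φu with IsPartialAut.dom-closed pa u (antipodeB u) (c , φu) (dB-antipode u)
... | c' , φū = trans φū (cong just (dB≡3⇒antipode c c'
                  (trans (IsPartialAut.isometry pa u (antipodeB u) c c' φu φū) (dB-antipode u))))

module Embedding {N : ℕ} (dA : Fin N → Fin N → ℕ) (isA : IsAntipodal3 dA)
  (p : Fin N → Bool) (p-anti : ∀ a b → dA a b ≡ 3 → p b ≡ not (p a))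
  (n : ℕ) (x : Fin n → Fin N)
  (x-p : ∀ i → p (x i) ≡ false) (x-surj : ∀ a → p a ≡ false → ∃ λ i → x i ≡ a) where

  open Setup dA isA p p-anti n x x-p x-surj

  InA' : PtB n → Set
  InA' b = ∃ λ a → ψ a ≡ b

  -- ψ(x_i) = (e_i , χ_i).
  base : Fin n → PtB n
  base i = i , χ i

  χ-diag : ∀ i → lookup (χ i) i ≡ false
  χ-diag i = trans (VecP.lookup∘tabulate _ i) diag
    where
    diag : (if toℕ i Nat.≤ᵇ toℕ i then false else (if dA (x i) (x i) Nat.≡ᵇ 1 then false else true)) ≡ false
    diag rewrite Equivalence.to BoolP.T-≡ (NatP.≤⇒≤ᵇ (NatP.≤-refl {toℕ i})) = refl

  ψ-cases : ∀ a → ψ a ≡ base (idx a) × p a ≡ false ⊎ ψ a ≡ antipodeB (base (idx a)) × p a ≡ true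
  ψ-cases a = cases (p a) refl
    where
    cases : ∀ b → p a ≡ b →
      (idx a , (if b then map not (χ (idx a)) else χ (idx a))) ≡ base (idx a) × p a ≡ false ⊎
      (idx a , (if b then map not (χ (idx a)) else χ (idx a))) ≡ antipodeB (base (idx a)) × p a ≡ true
    cases false pa = inj₁ (refl , pa)
    cases true  pa = inj₂ (refl , pa)

  A'-point : ∀ {b} → InA' b → b ≡ base (proj₁ b) ⊎ b ≡ antipodeB (base (proj₁ b))
  A'-point (a , refl) with ψ-cases a
  ... | inj₁ (ψa≡ , _) = inj₁ ψa≡
  ... | inj₂ (ψa≡ , _) = inj₂ ψa≡

  p̂ψ : ∀ a → diagonal (ψ a) ≡ p a
  p̂ψ a with ψ-cases a
  ... | inj₁ (ψa≡ , pa) = trans (cong diagonal ψa≡) (trans (χ-diag (idx a)) (sym pa))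
  ... | inj₂ (ψa≡ , pa) = trans (cong diagonal ψa≡)
        (trans (VecP.lookup-map (idx a) not (χ (idx a))) (trans (cong not (χ-diag (idx a))) (sym pa)))

  A'-same-index : ∀ {u v} → InA' u → InA' v → proj₁ u ≡ proj₁ v → v ≡ u ⊎ v ≡ antipodeB u
  A'-same-index u∈ v∈ refl with A'-point u∈ | A'-point v∈
  ... | inj₁ refl | inj₁ refl = inj₁ refl
  ... | inj₁ refl | inj₂ refl = inj₂ refl
  ... | inj₂ refl | inj₁ refl = inj₂ (sym (antipodeB-involutive _))
  ... | inj₂ refl | inj₂ refl = inj₁ refl

  onBase : PMap n → Vec (Maybe (PtB n)) n
  onBase φ = tabulate λ i → φ (base i)

  module Induced (w : Vec (Maybe (PtB n)) n) where
    dom : Vec Bool n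
    dom = map is-just w

    -- The image of base i (meaningful for i ∈ dom).
    target : Fin n → PtB n
    target i = fromMaybe (base i) (lookup w i)

    s : Fin n → Fin n
    s i = proj₁ (target i)

    open Extension dom s public

    -- Chosen so that the switching sends base e to target e for e ∈ dom,
    -- and symmetric, so that the switching is an isometry.
    twist : Fin n → Fin n → Bool
    twist e f = if lookup dom e then lookup (χ e) f xor lookup (proj₂ (target e)) (extend f)
                else if lookup dom f then lookup (χ f) e xor lookup (proj₂ (target f)) (extend e)
                else false

    θ-map : PtB n → PtB n
    θ-map = switch extend extend⁻¹ twist

    twist-in : ∀ e f → lookup dom e ≡ true →
      twist e f ≡ lookup (χ e) f xor lookup (proj₂ (target e)) (extend f)
    twist-in e f De rewrite De = refl

    twist-out : ∀ e f → lookup dom e ≡ false → lookup dom f ≡ false → twist e f ≡ false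
    twist-out e f De Df rewrite De | Df = refl

  module PartialAut (φ : PMap n) (pa : IsPartialAut InA' φ) where
    open IsPartialAut pa
    open Induced (onBase φ) public

    lookup-onBase : ∀ i → lookup (onBase φ) i ≡ φ (base i)
    lookup-onBase i = VecP.lookup∘tabulate _ i

    dom-true : ∀ i → lookup dom i ≡ true → φ (base i) ≡ just (target i)
    dom-true i Di = trans (sym (lookup-onBase i))
      (just-fromMaybe (lookup (onBase φ) i) (trans (sym (VecP.lookup-map i is-just (onBase φ))) Di))

    onBase-target : ∀ i c → φ (base i) ≡ just c → lookup dom i ≡ true × c ≡ target i
    onBase-target i c φb =
      trans (VecP.lookup-map i is-just (onBase φ)) (cong is-just w≡) , sym (cong (fromMaybe (base i)) w≡)
      where
      w≡ : lookup (onBase φ) i ≡ just c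
      w≡ = trans (lookup-onBase i) φb

    φ-via-target : ∀ b c → φ b ≡ just c → lookup dom (proj₁ b) ≡ true ×
      (b ≡ base (proj₁ b) × c ≡ target (proj₁ b) ⊎
       b ≡ antipodeB (base (proj₁ b)) × c ≡ antipodeB (target (proj₁ b)))
    φ-via-target b c φb with A'-point (proj₁ (dom-sub b c φb))
    φ-via-target (i , _) c φb | inj₁ refl with onBase-target i c φb
    ... | Di , c≡ = Di , inj₁ (refl , c≡)
    φ-via-target (i , _) c φb | inj₂ refl
      with onBase-target i (antipodeB c)
             (subst (λ u → φ u ≡ just (antipodeB c)) (antipodeB-involutive (base i))
                    (partialAut-antipode pa _ c φb))
    ... | Di , c̄≡ = Di , inj₂ (refl , trans (sym (antipodeB-involutive c)) (cong antipodeB c̄≡))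

    target∈A' : ∀ i → lookup dom i ≡ true → InA' (target i)
    target∈A' i Di = proj₂ (dom-sub _ _ (dom-true i Di))

    -- Distinct base points in the domain have targets with distinct indices:
    -- targets with the same index are equal or antipodal, and φ is an
    -- injective isometry.
    s-injective : InjectiveOn dom s
    s-injective i i' Di Di' si≡si' with A'-same-index (target∈A' i Di) (target∈A' i' Di') si≡si'
    ... | inj₁ t'≡t = cong proj₁ (injective (base i) (base i') (target i) (dom-true i Di)
                                    (trans (dom-true i' Di') (cong just t'≡t)))
    ... | inj₂ t'≡t̄ = sym (cong proj₁ (dB≡3⇒antipode (base i) (base i')
                        (trans (sym (isometry _ _ _ _ (dom-true i Di) (dom-true i' Di')))
                               (trans (cong (dB (target i)) t'≡t̄) (dB-antipode (target i))))))

    -- For e ≠ f in the domain, φ preserves agreement of base e and base f,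
    -- which is the symmetry of the twist.
    twist-sym : Symmetric twist
    twist-sym e f with lookup dom e in De | lookup dom f in Df
    ... | false | false = refl
    ... | false | true  = refl
    ... | true  | false = refl
    ... | true  | true with e FinP.≟ f
    ...   | yes refl = refl
    ...   | no e≢f   = xor-≡ (isometry-agree (base e) (base f) (target e) (target f)
                                (isometry _ _ _ _ (dom-true e De) (dom-true f Df))
                                e≢f (λ se≡sf → e≢f (s-injective e f De Df se≡sf)))

    σ : Permutation′ n
    σ = extension s-injective

    θ : AutB n
    θ = switchAut σ twist twist-sym

    -- θ_φ sends base i to target i: the twist was chosen to cancel χ_i.
    θ-base : ∀ i → lookup dom i ≡ true → θ-map (base i) ≡ target i
    θ-base i Di = cong₂ _,_ (extend-in i Di) (lookup-ext-along σ λ f →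
      begin
        lookup (proj₂ (θ-map (base i))) (σ ⟨$⟩ʳ f)
      ≡⟨ lookup-switch σ twist i (χ i) f ⟩
        lookup (χ i) f xor twist i f
      ≡⟨ cong (lookup (χ i) f xor_) (twist-in i f Di) ⟩
        lookup (χ i) f xor (lookup (χ i) f xor lookup (proj₂ (target i)) (extend f))
      ≡⟨ sym (BoolP.xor-assoc (lookup (χ i) f) _ _) ⟩
        (lookup (χ i) f xor lookup (χ i) f) xor lookup (proj₂ (target i)) (extend f)
      ≡⟨ cong (_xor lookup (proj₂ (target i)) (extend f)) (BoolP.xor-same (lookup (χ i) f)) ⟩
        lookup (proj₂ (target i)) (σ ⟨$⟩ʳ f)
      ∎)
      where open ≡-Reasoning

    θ-extends : ∀ b c → φ b ≡ just c → θ-map b ≡ c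
    θ-extends b c φb with φ-via-target b c φb
    ... | Di , inj₁ (refl , c≡) = trans (θ-base (proj₁ b) Di) (sym c≡)
    ... | Di , inj₂ (refl , c≡) =
      trans (switch-antipode σ twist (base (proj₁ b))) (trans (cong antipodeB (θ-base (proj₁ b) Di)) (sym c≡))

    image→range : ∀ j → lookup image j ≡ true → Range φ (base j)
    image→range j Rj with preimage-spec j Rj
    ... | Di , si≡j = subst (λ k → Range φ (base k)) si≡j (target-range (A'-point (target∈A' i Di)))
      where
      i = preimage j
      target-range : target i ≡ base (s i) ⊎ target i ≡ antipodeB (base (s i)) → Range φ (base (s i))
      target-range (inj₁ t≡) = base i , trans (dom-true i Di) (cong just t≡)
      target-range (inj₂ t≡) = antipodeB (base i) ,
        trans (partialAut-antipode pa _ _ (dom-true i Di))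
              (cong just (trans (cong antipodeB t≡) (antipodeB-involutive _)))

    range→image : ∀ j → Range φ (base j) → lookup image j ≡ true
    range→image j (b , φb) with φ-via-target b (base j) φb
    ... | Di , inj₁ (_ , j≡) = subst (λ k → lookup image k ≡ true) (sym (cong proj₁ j≡)) (image-s _ Di)
    ... | Di , inj₂ (_ , j≡) = subst (λ k → lookup image k ≡ true) (sym (cong proj₁ j≡)) (image-s _ Di)

    dom→Dom : ∀ i → lookup dom i ≡ true → Dom φ (base i)
    dom→Dom i Di = target i , dom-true i Di

    Dom→dom : ∀ i → Dom φ (base i) → lookup dom i ≡ true
    Dom→dom i (c , φb) = proj₁ (onBase-target i c φb)

    -- If φ preserves p, the twist vanishes on the diagonal: the target of
    -- base e has the same colour c(e) as base e, namely χ_e(e) = 0.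
    twist-diag : (∀ a a' → φ (ψ a) ≡ just (ψ a') → p a' ≡ p a) → ∀ e → twist e e ≡ false
    twist-diag pres e = byDomain (lookup dom e) refl
      where
      byDomain : ∀ b → lookup dom e ≡ b → twist e e ≡ false
      byDomain false De = twist-out e e De De
      byDomain true  De with dom-sub _ _ (dom-true e De)
      ... | (a , ψa≡) , (a' , ψa'≡) =
        begin
          twist e e
        ≡⟨ twist-in e e De ⟩
          lookup (χ e) e xor lookup (proj₂ (target e)) (extend e)
        ≡⟨ cong (λ k → lookup (χ e) e xor lookup (proj₂ (target e)) k) (extend-in e De) ⟩
          lookup (χ e) e xor diagonal (target e)
        ≡⟨ cong₂ _xor_ (χ-diag e) (cong diagonal (sym ψa'≡)) ⟩
          diagonal (ψ a')
        ≡⟨ p̂ψ a' ⟩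
          p a'
        ≡⟨ pres a a' (trans (cong φ ψa≡) (trans (dom-true e De) (cong just (sym ψa'≡)))) ⟩
          p a
        ≡⟨ sym (p̂ψ a) ⟩
          diagonal (ψ a)
        ≡⟨ cong diagonal ψa≡ ⟩
          lookup (χ e) e
        ≡⟨ χ-diag e ⟩
          false
        ∎
        where open ≡-Reasoning

  module Coherence (f g h : PMap n) (pf : IsPartialAut InA' f) (pg : IsPartialAut InA' g)
                   (ph : IsPartialAut InA' h) (coh : Coherent f g h) where
    module F = PartialAut f pf
    module G = PartialAut g pg
    module H = PartialAut h ph
    open Equivalence

    Dom-f⇔h : ∀ b → Dom f b ⇔ Dom h b
    Dom-f⇔h = proj₁ coh
    Range-f⇔Dom-g : ∀ b → Range f b ⇔ Dom g b
    Range-f⇔Dom-g = proj₁ (proj₂ coh)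
    Range-g⇔h : ∀ b → Range g b ⇔ Range h b
    Range-g⇔h = proj₁ (proj₂ (proj₂ coh))
    h≡g∘f : ∀ b → h b ≡ (f b >>= g)
    h≡g∘f = proj₂ (proj₂ (proj₂ coh))

    dom-h : H.dom ≡ F.dom
    dom-h = lookup-ext λ i → bool-ext
      (λ Dh → F.Dom→dom i (from (Dom-f⇔h (base i)) (H.dom→Dom i Dh)))
      (λ Df → H.Dom→dom i (to (Dom-f⇔h (base i)) (F.dom→Dom i Df)))

    image-f : F.image ≡ G.dom
    image-f = lookup-ext λ j → bool-ext
      (λ Rf → G.Dom→dom j (to (Range-f⇔Dom-g (base j)) (F.image→range j Rf)))
      (λ Dg → F.range→image j (from (Range-f⇔Dom-g (base j)) (G.dom→Dom j Dg)))

    image-h : H.image ≡ G.image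
    image-h = lookup-ext λ j → bool-ext
      (λ Rh → G.range→image j (from (Range-g⇔h (base j)) (H.image→range j Rh)))
      (λ Rg → H.range→image j (to (Range-g⇔h (base j)) (G.image→range j Rg)))

    Dh : ∀ i → lookup F.dom i ≡ true → lookup H.dom i ≡ true
    Dh i Df = trans (cong (λ D → lookup D i) dom-h) Df

    Dg : ∀ i → lookup F.dom i ≡ true → lookup G.dom (F.s i) ≡ true
    Dg i Df = trans (cong (λ D → lookup D (F.s i)) (sym image-f)) (F.image-s i Df)

    -- h(base i) = g(f(base i)) and θ_g extends g.
    target-h : ∀ i → lookup F.dom i ≡ true → H.target i ≡ G.θ-map (F.target i)
    target-h i Df = sym (G.θ-extends (F.target i) (H.target i)
      (trans (sym (trans (h≡g∘f (base i)) (cong (_>>= g) (F.dom-true i Df)))) (H.dom-true i (Dh i Df))))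

    s-h : ∀ i → lookup F.dom i ≡ true → H.s i ≡ G.s (F.s i)
    s-h i Df = trans (cong proj₁ (target-h i Df)) (G.extend-in (F.s i) (Dg i Df))

    σ-h : ∀ i → H.extend i ≡ G.extend (F.extend i)
    σ-h = extend-∘ F.dom G.dom H.dom F.s G.s H.s F.s-injective G.s-injective dom-h image-f image-h s-h

    -- The twists compose as in switch-∘.  For e in the domain this is the
    -- defining property of the switching θ_g applied to target_f(e); the mixed
    -- case follows by symmetry, and outside the domain all twists vanish.
    twist-h-in : ∀ e j → lookup F.dom e ≡ true →
      H.twist e j ≡ F.twist e j xor G.twist (F.extend e) (F.extend j)
    twist-h-in e j De =
      begin
        H.twist e j
      ≡⟨ H.twist-in e j (Dh e De) ⟩
        lookup (χ e) j xor lookup (proj₂ (H.target e)) (H.extend j)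
      ≡⟨ cong₂ (λ t k → lookup (χ e) j xor lookup (proj₂ t) k) (target-h e De) (σ-h j) ⟩
        lookup (χ e) j xor lookup (proj₂ (G.θ-map (F.target e))) (G.σ ⟨$⟩ʳ F.extend j)
      ≡⟨ cong (lookup (χ e) j xor_) (lookup-switch G.σ G.twist (F.s e) (proj₂ (F.target e)) (F.extend j)) ⟩
        lookup (χ e) j xor (lookup (proj₂ (F.target e)) (F.extend j) xor G.twist (F.s e) (F.extend j))
      ≡⟨ sym (BoolP.xor-assoc (lookup (χ e) j) _ _) ⟩
        (lookup (χ e) j xor lookup (proj₂ (F.target e)) (F.extend j)) xor G.twist (F.s e) (F.extend j)
      ≡⟨ cong₂ (λ t k → t xor G.twist k (F.extend j)) (sym (F.twist-in e j De)) (sym (F.extend-in e De)) ⟩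
        F.twist e j xor G.twist (F.extend e) (F.extend j)
      ∎
      where open ≡-Reasoning

    twist-h : ∀ e j → H.twist e j ≡ F.twist e j xor G.twist (F.extend e) (F.extend j)
    twist-h e j = byDomain (lookup F.dom e) refl (lookup F.dom j) refl
      where
      byDomain : ∀ a → lookup F.dom e ≡ a → ∀ b → lookup F.dom j ≡ b →
        H.twist e j ≡ F.twist e j xor G.twist (F.extend e) (F.extend j)
      byDomain true De _ _ = twist-h-in e j De
      byDomain false De true Dj =
        trans (H.twist-sym e j) (trans (twist-h-in j e Dj) (cong₂ _xor_ (F.twist-sym j e) (G.twist-sym _ _)))
      byDomain false De false Dj = trans (H.twist-out e j (outside-h De) (outside-h Dj))
        (sym (cong₂ _xor_ (F.twist-out e j De Dj) (G.twist-out _ _ (outside-g De) (outside-g Dj))))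
        where
        outside-h : ∀ {i} → lookup F.dom i ≡ false → lookup H.dom i ≡ false
        outside-h {i} Di = trans (cong (λ D → lookup D i) dom-h) Di
        outside-g : ∀ {i} → lookup F.dom i ≡ false → lookup G.dom (F.extend i) ≡ false
        outside-g {i} Di = trans (cong (λ D → lookup D (F.extend i)) (sym image-f)) (F.extend-gap F.s-injective i Di)

    θ-h : ∀ b → H.θ-map b ≡ G.θ-map (F.θ-map b)
    θ-h = switch-∘ F.σ G.σ H.σ F.twist G.twist H.twist σ-h twist-h

proposition3p2 :
    ∀ {N : ℕ} (dA : Fin N → Fin N → ℕ) (isA : IsAntipodal3 dA)
      (p : Fin N → Bool)
      (p-anti : ∀ a b → dA a b ≡ 3 → p b ≡ not (p a))
      (n : ℕ) (x : Fin n → Fin N)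
      (x-inj : Injective _≡_ _≡_ x)
      (x-p : ∀ i → p (x i) ≡ false)
      (x-surj : ∀ a → p a ≡ false → Σ (Fin n) λ i → x i ≡ a) →
    let open Setup dA isA p p-anti n x x-p x-surj in
    let InA' : PtB n → Set
        InA' b = ∃ λ a → ψ a ≡ b in
    IsAntipodal3 (dB {n}) ×
    Σ ((φ : PMap n) → IsPartialAut InA' φ → AutB n) λ θ →
      (∀ φ φ' (i : IsPartialAut InA' φ) (i' : IsPartialAut InA' φ') →
         (∀ b → φ b ≡ φ' b) → ∀ b → AutB.to (θ φ i) b ≡ AutB.to (θ φ' i') b) ×
      (∀ φ (i : IsPartialAut InA' φ) b c → φ b ≡ just c → AutB.to (θ φ i) b ≡ c) ×
      (∀ f g h (i : IsPartialAut InA' f) (j : IsPartialAut InA' g) (k : IsPartialAut InA' h) →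
         Coherent f g h → Coherent (asPMap (θ f i)) (asPMap (θ g j)) (asPMap (θ h k))) ×
      Σ (PtB n → Bool) λ p̂ →
        (∀ a → p̂ (ψ a) ≡ p a) ×
        (∀ φ (i : IsPartialAut InA' φ) →
           (∀ a a' → φ (ψ a) ≡ just (ψ a') → p a' ≡ p a) →
           ∀ b → p̂ (AutB.to (θ φ i) b) ≡ p̂ b)
proposition3p2 dA isA p p-anti n x _ x-p x-surj =
  B-isAntipodal3 ,
  PartialAut.θ ,
  -- θ_φ depends only on the values of φ on the base points.
  (λ φ φ' _ _ φ≗φ' b → cong (λ w → Induced.θ-map w b) (VecP.tabulate-cong (λ i → φ≗φ' (base i)))) ,
  PartialAut.θ-extends ,
  (λ f g h pf pg ph coh → aut-coherent (PartialAut.θ f pf) (PartialAut.θ g pg) (PartialAut.θ h ph)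
                            (Coherence.θ-h f g h pf pg ph coh)) ,
  -- p̂(e , c) = c(e), preserved because p-preserving φ give twists vanishing on the diagonal.
  diagonal ,
  p̂ψ ,
  (λ φ pa pres → switch-diagonal (PartialAut.σ φ pa) (PartialAut.twist φ pa) (PartialAut.twist-diag φ pa pres))
  where open Embedding dA isA p p-anti n x x-p x-surj
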